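{- For every path $P$ on at least $4$ vertices, $4\le \pi_T(P)\le 5$.
   Context: A sequence is nonrepetitive if it contains no block of consecutive terms $r_1\dots r_{2n}$ ($n\ge1$) with $r_i=r_{n+i}$ for all $i$. For a graph $G$, a (strong) total Thue colouring is a colouring $\varphi$ of $V(G)\cup E(G)$ such that for every path $v_0e_1v_1\dots e_kv_k$ in $G$ the three sequences $\varphi(v_0)\varphi(e_1)\varphi(v_1)\dots\varphi(e_k)\varphi(v_k)$, $\varphi(v_0)\varphi(v_1)\dots\varphi(v_k)$ and $\varphi(e_1)\dots\varphi(e_k)$ are all nonrepetitive. $\pi_T(G)$ is the minimum number of colours in a total Thue colouring of $G$. -}

module Defs where

open import Data.Nat using (ℕ; suc; _<_; _⊔_; _⊓_)
open import Data.Fin using (Fin)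
open import Data.List using (List; []; _∷_; _++_; map)
open import Data.List.Relation.Unary.All using (All)
open import Data.List.Relation.Unary.Linked using (Linked)
open import Data.List.Relation.Unary.Unique.Propositional using (Unique)
open import Data.Product using (Σ; ∃; _×_; _,_)
open import Data.Sum using (_⊎_)
open import Relation.Binary.PropositionalEquality using (_≡_; _≢_)
open import Relation.Nullary using (¬_)

Repetitive : {A : Set} → List A → Set
Repetitive {A} xs =
  Σ (List A) λ pre → Σ (List A) λ r → Σ (List A) λ suf →
    (r ≢ []) × (xs ≡ pre ++ (r ++ (r ++ suf)))

Nonrepetitive : {A : Set} → List A → Set
Nonrepetitive xs = ¬ Repetitive xs

-- The path graph P_n: vertices 0,…,n-1; for i+1 < n an edge joining i and i+1.
-- The edge joining u and u+1 is named by its smaller endpoint u, so the edge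
-- between adjacent vertices u, v is  u ⊓ v.
Adjacent : ℕ → ℕ → Set
Adjacent u v = (suc u ≡ v) ⊎ (suc v ≡ u)

IsPath : ℕ → List ℕ → Set
IsPath n vs = (vs ≢ []) × All (_< n) vs × Unique vs × Linked Adjacent vs

edgeOf : ℕ → ℕ → ℕ
edgeOf u v = u ⊓ v

-- Both are given as functions on ℕ (vertex i, edge named i); values at
-- indices outside V(P_n) resp. E(P_n) are irrelevant.
record TotalColouring (c : ℕ) : Set where
  constructor mkCol
  field
    vcol : ℕ → Fin c
    ecol : ℕ → Fin c
open TotalColouring public

module _ {c : ℕ} (φ : TotalColouring c) where
  vertexSeq : List ℕ → List (Fin c)
  vertexSeq vs = map (vcol φ) vs

  edgeSeq : List ℕ → List (Fin c)
  edgeSeq [] = []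
  edgeSeq (u ∷ []) = []
  edgeSeq (u ∷ v ∷ vs) = ecol φ (edgeOf u v) ∷ edgeSeq (v ∷ vs)

  totalSeq : List ℕ → List (Fin c)
  totalSeq [] = []
  totalSeq (u ∷ []) = vcol φ u ∷ []
  totalSeq (u ∷ v ∷ vs) = vcol φ u ∷ ecol φ (edgeOf u v) ∷ totalSeq (v ∷ vs)

IsTotalThue : (n : ℕ) {c : ℕ} → TotalColouring c → Set
IsTotalThue n φ = (vs : List ℕ) → IsPath n vs →
  Nonrepetitive (totalSeq φ vs) × Nonrepetitive (vertexSeq φ vs)
    × Nonrepetitive (edgeSeq φ vs)

HasTotalThue : ℕ → ℕ → Set
HasTotalThue n c = Σ (TotalColouring c) λ φ → IsTotalThue n φ

module Submission where

-- Lower bound: along the path 0 1 2 3, consecutive terms of the total sequence a₀ e₀ a₁ e₁ a₂ e₂ a₃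
-- differ, as do consecutive vertex colours and consecutive edge colours. So every term from e₁ on differs
-- from its two predecessors, which differ from each other; with at most three colours the sequence thus has
-- period three, and a₀ e₀ a₁ e₁ a₂ e₂ is a square.
--
-- Upper bound: with t the Thue–Morse sequence, colour vertex x by the pair (t x, t (x+1)) and the edge
-- {x, x+1} by (not t (x+1), t x). Every path is an interval traversed in one of the two directions, so it
-- suffices that the vertex colours, the edge colours and their interleaving are square-free sequences. A
-- square in the vertex or the edge colours is an overlap in t, which Thue's theorem rules out (an overlap
-- of even period halves via t (2n) = t n, t (2n+1) = not (t n); one of odd period forces three equal
-- consecutive terms). An even square of the interleaving is a square of vertex or of edge colours, and an
-- odd one matches vertex colours against edge colours, which forces t i = t (i+1) = not (t i). Only four
-- of the five colours are used.

open import Defs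
open import Data.Bool using (Bool; true; false; not; _xor_)
open import Data.Bool.Properties using (not-injective; not-involutive; not-¬)
open import Data.Empty using (⊥; ⊥-elim)
open import Data.Fin as Fin using (Fin; inject₁)
open import Data.Fin.Properties using (inject₁-injective; injective⇒≤)
open import Data.List using (List; []; _∷_; _++_; length; map; reverse; _∷ʳ_)
open import Data.List.Properties using (reverse-++; reverse-involutive; reverse-map; ++-assoc; ∷-injective)
open import Data.List.Relation.Unary.All using (_∷_; [])
open import Data.List.Relation.Unary.AllPairs using (_∷_; [])
open import Data.List.Relation.Unary.Linked using (Linked; _∷_; [-])
open import Data.List.Relation.Unary.Unique.Propositional using (Unique)
open import Data.Nat using (ℕ; zero; suc; _+_; _∸_; _⊓_; _≤_; _<_; z≤n; s≤s; ⌊_/2⌋)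
open import Data.Nat.Induction using (<-rec)
open import Data.Nat.Properties
open import Data.Nat.Tactic.RingSolver using (solve-∀)
open import Data.Product using (Σ; ∃₂; _×_; _,_; proj₁; proj₂)
open import Data.Sum using (inj₁; inj₂)
open import Data.Vec using (_∷_; [])
open import Data.Vec.Relation.Unary.All using (_∷_; [])
open import Data.Vec.Relation.Unary.AllPairs using (_∷_; [])
import Data.Vec.Relation.Unary.Unique.Propositional as Vec
open import Data.Vec.Relation.Unary.Unique.Propositional.Properties using (lookup-injective)
open import Function using (_∘_)
open import Relation.Binary.PropositionalEquality
open import Relation.Nullary using (¬_)
open import Relation.Nullary.Decidable using (decidable-stable)

private
  variable
    A : Set

ascending : ℕ → ℕ → List ℕ
ascending a zero    = []
ascending a (suc L) = a ∷ ascending (suc a) L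

descending : ℕ → ℕ → List ℕ
descending b zero    = []
descending b (suc L) = L + b ∷ descending b L

ascending-∷ʳ : ∀ a L → ascending a (suc L) ≡ ascending a L ∷ʳ (a + L)
ascending-∷ʳ a zero    = cong (_∷ []) (sym (+-identityʳ a))
ascending-∷ʳ a (suc L) =
  cong (a ∷_) (trans (ascending-∷ʳ (suc a) L) (cong (ascending (suc a) L ∷ʳ_) (sym (+-suc a L))))

descending≡reverse-ascending : ∀ b L → descending b L ≡ reverse (ascending b L)
descending≡reverse-ascending b zero    = refl
descending≡reverse-ascending b (suc L) = begin
  L + b ∷ descending b L             ≡⟨ cong₂ _∷_ (+-comm L b) (descending≡reverse-ascending b L) ⟩
  b + L ∷ reverse (ascending b L)    ≡⟨ sym (reverse-++ (ascending b L) (b + L ∷ [])) ⟩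
  reverse (ascending b L ∷ʳ (b + L)) ≡⟨ cong reverse (sym (ascending-∷ʳ b L)) ⟩
  reverse (ascending b (suc L))      ∎
  where open ≡-Reasoning

record Agree (s : ℕ → A) (a b L : ℕ) : Set where
  field
    at : ∀ j → j ≤ L → s (a + j) ≡ s (b + j)
open Agree public

module _ {s : ℕ → A} where

  agree-head : ∀ {a b L} → Agree s a b L → s a ≡ s b
  agree-head {a} {b} ag = subst₂ (λ x y → s x ≡ s y) (+-identityʳ a) (+-identityʳ b) (ag .at 0 z≤n)

  agree-tail : ∀ {a b L} → Agree s a b (suc L) → Agree s (suc a) (suc b) L
  agree-tail {a} {b} ag .at j j≤L =
    subst₂ (λ x y → s x ≡ s y) (+-suc a j) (+-suc b j) (ag .at (suc j) (s≤s j≤L))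

  agree-zero : ∀ {a b} → s a ≡ s b → Agree s a b 0
  agree-zero {a} {b} e .at zero z≤n =
    subst₂ (λ x y → s x ≡ s y) (sym (+-identityʳ a)) (sym (+-identityʳ b)) e

  agree-cons : ∀ {a b L} → s a ≡ s b → Agree s (suc a) (suc b) L → Agree s a b (suc L)
  agree-cons e ag .at zero    _ = agree-zero e .at zero z≤n
  agree-cons {a} {b} e ag .at (suc j) (s≤s j≤L) =
    subst₂ (λ x y → s x ≡ s y) (sym (+-suc a j)) (sym (+-suc b j)) (ag .at j j≤L)

  agree-weaken : ∀ {a b L L′} → L′ ≤ L → Agree s a b L → Agree s a b L′
  agree-weaken L′≤L ag .at j j≤L′ = ag .at j (≤-trans j≤L′ L′≤L)

  agree-sym : ∀ {a b L} → Agree s a b L → Agree s b a L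
  agree-sym ag .at j j≤L = sym (ag .at j j≤L)

  agree-extend : ∀ {a b L} → Agree s a b L → s (a + suc L) ≡ s (b + suc L) → Agree s a b (suc L)
  agree-extend ag last .at j j≤1+L with m≤n⇒m<n∨m≡n j≤1+L
  ... | inj₁ j<1+L = ag .at j (≤-pred j<1+L)
  ... | inj₂ refl  = last

agree-cong : ∀ {f g : ℕ → A} → (∀ x → f x ≡ g x) → ∀ {a b L} → Agree f a b L → Agree g a b L
agree-cong f≗g {a} {b} ag .at j j≤L =
  trans (sym (f≗g (a + j))) (trans (ag .at j j≤L) (f≗g (b + j)))

agree-map : ∀ {B : Set} (f : A → B) {s a b L} → Agree s a b L → Agree (f ∘ s) a b L
agree-map f ag .at j j≤L = cong f (ag .at j j≤L)

agree-injective : ∀ {B : Set} {f : A → B} → (∀ {x y} → f x ≡ f y → x ≡ y) →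
  ∀ {s a b L} → Agree (f ∘ s) a b L → Agree s a b L
agree-injective f-inj ag .at j j≤L = f-inj (ag .at j j≤L)

SquareFree : (ℕ → A) → Set
SquareFree s = ∀ p m → ¬ Agree s p (p + suc m) m

squareFree-cong : ∀ {f g : ℕ → A} → (∀ x → f x ≡ g x) → SquareFree f → SquareFree g
squareFree-cong f≗g sf p m = sf p m ∘ agree-cong (sym ∘ f≗g)

squareFree-∘ : ∀ {B : Set} {f : A → B} → (∀ {x y} → f x ≡ f y → x ≡ y) →
  ∀ {s} → SquareFree s → SquareFree (f ∘ s)
squareFree-∘ f-inj sf p m = sf p m ∘ agree-injective f-inj

module _ (s : ℕ → A) where

  window-++ : ∀ a L xs {ys} → map s (ascending a L) ≡ xs ++ ys →
    map s (ascending a (length xs)) ≡ xs × map s (ascending (a + length xs) (L ∸ length xs)) ≡ ys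
  window-++ a L       []       {ys} eq =
    refl , subst (λ x → map s (ascending x L) ≡ ys) (sym (+-identityʳ a)) eq
  window-++ a zero    (x ∷ xs) ()
  window-++ a (suc L) (x ∷ xs) {ys} eq with ∷-injective eq
  ... | refl , eq′ with window-++ (suc a) L xs eq′
  ...   | pre , suf =
    cong (s a ∷_) pre ,
    subst (λ x → map s (ascending x (L ∸ length xs)) ≡ ys) (sym (+-suc a (length xs))) suf

  windows-agree : ∀ a b L → map s (ascending a (suc L)) ≡ map s (ascending b (suc L)) →
                  Agree s a b L
  windows-agree a b zero    eq = agree-zero {s = s} (proj₁ (∷-injective eq))
  windows-agree a b (suc L) eq with ∷-injective eq
  ... | head , tail = agree-cons {s = s} head (windows-agree (suc a) (suc b) L tail)

  window-square : ∀ a L → Repetitive (map s (ascending a L)) →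
                  ∃₂ λ p m → Agree s p (p + suc m) m
  window-square a L (pre , []      , suf , r≢[] , eq) = ⊥-elim (r≢[] refl)
  window-square a L (pre , x ∷ r′ , suf , _    , eq) =
    let r = x ∷ r′
        p = a + length pre
        _      , rrsuf = window-++ a L pre eq
        first  , rsuf  = window-++ p (L ∸ length pre) r rrsuf
        second , _     = window-++ (p + length r) _ r rsuf
    in p , length r′ , windows-agree p (p + length r) (length r′) (trans first (sym second))

repetitive-reverse : {xs : List A} → Repetitive xs → Repetitive (reverse xs)
repetitive-reverse {xs = xs} (pre , r , suf , r≢[] , eq) =
  reverse suf , reverse r , reverse pre , reverse-≢[] , (begin
    reverse xs                                                ≡⟨ cong reverse eq ⟩
    reverse (pre ++ (r ++ (r ++ suf)))                        ≡⟨ reverse-++ pre _ ⟩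
    reverse (r ++ (r ++ suf)) ++ reverse pre                  ≡⟨ cong (_++ reverse pre) (reverse-++ r _) ⟩
    (reverse (r ++ suf) ++ reverse r) ++ reverse pre
      ≡⟨ cong (λ z → (z ++ reverse r) ++ reverse pre) (reverse-++ r suf) ⟩
    ((reverse suf ++ reverse r) ++ reverse r) ++ reverse pre  ≡⟨ ++-assoc (reverse suf ++ reverse r) _ _ ⟩
    (reverse suf ++ reverse r) ++ (reverse r ++ reverse pre)  ≡⟨ ++-assoc (reverse suf) (reverse r) _ ⟩
    reverse suf ++ (reverse r ++ (reverse r ++ reverse pre))  ∎)
  where
  open ≡-Reasoning
  reverse-≢[] : reverse r ≢ []
  reverse-≢[] e = r≢[] (trans (sym (reverse-involutive r)) (cong reverse e))

module _ {s : ℕ → A} (sf : SquareFree s) where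

  squareFree-ascending : ∀ a L → Nonrepetitive (map s (ascending a L))
  squareFree-ascending a L rep with window-square s a L rep
  ... | p , m , ag = sf p m ag

  squareFree-descending : ∀ b L → Nonrepetitive (map s (descending b L))
  squareFree-descending b L rep =
    squareFree-ascending b L (subst Repetitive same (repetitive-reverse rep))
    where
    same : reverse (map s (descending b L)) ≡ map s (ascending b L)
    same = begin
      reverse (map s (descending b L))          ≡⟨ cong (reverse ∘ map s) (descending≡reverse-ascending b L) ⟩
      reverse (map s (reverse (ascending b L))) ≡⟨ cong reverse (reverse-map s (ascending b L)) ⟩
      reverse (reverse (map s (ascending b L))) ≡⟨ reverse-involutive _ ⟩
      map s (ascending b L)                     ∎
      where open ≡-Reasoning

data EvenOdd : ℕ → Set where
  even : ∀ m → EvenOdd (m + m)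
  odd  : ∀ m → EvenOdd (suc (m + m))

evenOdd : ∀ n → EvenOdd n
evenOdd zero    = even zero
evenOdd (suc n) with evenOdd n
... | even m = odd m
... | odd m  = subst EvenOdd (cong suc (+-suc m m)) (even (suc m))

interleave : (ℕ → A) → (ℕ → A) → ℕ → A
interleave v e zero    = v zero
interleave v e (suc n) = interleave e (v ∘ suc) n

interleave-double : ∀ {v e : ℕ → A} n → interleave v e (n + n) ≡ v n
interleave-double zero    = refl
interleave-double {v = v} {e} (suc n) rewrite +-suc n n =
  interleave-double {v = v ∘ suc} {e ∘ suc} n

interleave-suc-double : ∀ {v e : ℕ → A} n → interleave v e (suc (n + n)) ≡ e n
interleave-suc-double {v = v} {e} = interleave-double {v = e} {v ∘ suc}

double-+-double : ∀ a j → a + a + (j + j) ≡ (a + j) + (a + j)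
double-+-double = solve-∀

double-+-odd : ∀ a k → a + a + suc (k + k) ≡ suc ((a + k) + (a + k))
double-+-odd = solve-∀

odd-+-odd : ∀ a k → suc (a + a) + suc (k + k) ≡ suc (a + k) + suc (a + k)
odd-+-odd = solve-∀

module _ {v e : ℕ → A} where

  agree-interleave-even : ∀ {a b L} → Agree (interleave v e) (a + a) (b + b) (L + L) →
                          Agree v a b L
  agree-interleave-even {a} {b} ag .at j j≤L = begin
    v (a + j)                          ≡⟨ sym (interleave-double (a + j)) ⟩
    interleave v e ((a + j) + (a + j)) ≡⟨ cong (interleave v e) (sym (double-+-double a j)) ⟩
    interleave v e (a + a + (j + j))   ≡⟨ ag .at (j + j) (+-mono-≤ j≤L j≤L) ⟩
    interleave v e (b + b + (j + j))   ≡⟨ cong (interleave v e) (double-+-double b j) ⟩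
    interleave v e ((b + j) + (b + j)) ≡⟨ interleave-double (b + j) ⟩
    v (b + j)                          ∎
    where open ≡-Reasoning

  agree-interleave-odd : ∀ {a b L} → Agree (interleave v e) (suc (a + a)) (suc (b + b)) (L + L) →
                         Agree e a b L
  agree-interleave-odd {a} {b} ag .at j j≤L = begin
    e (a + j)                               ≡⟨ sym (interleave-suc-double {v = v} (a + j)) ⟩
    interleave v e (suc ((a + j) + (a + j))) ≡⟨ cong (interleave v e ∘ suc) (sym (double-+-double a j)) ⟩
    interleave v e (suc (a + a + (j + j)))   ≡⟨ ag .at (j + j) (+-mono-≤ j≤L j≤L) ⟩
    interleave v e (suc (b + b + (j + j)))   ≡⟨ cong (interleave v e ∘ suc) (double-+-double b j) ⟩
    interleave v e (suc ((b + j) + (b + j))) ≡⟨ interleave-suc-double {v = v} (b + j) ⟩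
    e (b + j)                               ∎
    where open ≡-Reasoning

interleave-∘ : ∀ {B : Set} (f : A → B) (v e : ℕ → A) n →
               interleave (f ∘ v) (f ∘ e) n ≡ f (interleave v e n)
interleave-∘ f v e zero    = refl
interleave-∘ f v e (suc n) = interleave-∘ f e (v ∘ suc) n

interleave-squareFree : ∀ {v e : ℕ → A} → SquareFree v → SquareFree e →
  (∀ p m → ¬ Agree (interleave v e) p (p + suc (m + m)) (m + m)) → SquareFree (interleave v e)
interleave-squareFree {v = v} {e} sf-v sf-e no-odd p m with evenOdd m
... | even k = no-odd p k
... | odd k  = λ ag → even-square (subst (λ b → Agree T p b (suc (k + k))) (cong (p +_) q+q) ag)
  where
  T = interleave v e
  q+q : suc (suc (k + k)) ≡ suc k + suc k
  q+q = cong suc (sym (+-suc k k))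
  even-square : ¬ Agree T p (p + (suc k + suc k)) (suc (k + k))
  even-square ag with evenOdd p | agree-weaken (n≤1+n (k + k)) ag
  ... | even i | ag′ = sf-v i k (agree-interleave-even
                         (subst (λ b → Agree T (i + i) b (k + k)) (double-+-double i (suc k)) ag′))
  ... | odd i  | ag′ = sf-e i k (agree-interleave-odd
                         (subst (λ b → Agree T (suc (i + i)) b (k + k))
                                (cong suc (double-+-double i (suc k))) ag′))

isOdd : ℕ → Bool
isOdd zero    = false
isOdd (suc n) = not (isOdd n)

-- thueMorse n is the parity of the binary digit sum of n; the fuel f only has to satisfy n ≤ f.
thueMorseFuel : ℕ → ℕ → Bool
thueMorseFuel zero    n = false
thueMorseFuel (suc f) n = isOdd n xor thueMorseFuel f ⌊ n /2⌋

opaque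
  thueMorse : ℕ → Bool
  thueMorse n = thueMorseFuel (suc n) n

thueMorseFuel-irrelevant : ∀ {f g n} → n ≤ f → n ≤ g → thueMorseFuel f n ≡ thueMorseFuel g n
thueMorseFuel-irrelevant {zero}  {zero}  _   _   = refl
thueMorseFuel-irrelevant {zero}  {suc g} z≤n _   = thueMorseFuel-irrelevant {zero} {g} z≤n z≤n
thueMorseFuel-irrelevant {suc f} {zero}  _   z≤n = thueMorseFuel-irrelevant {f} {zero} z≤n z≤n
thueMorseFuel-irrelevant {suc f} {suc g} {n} n≤1+f n≤1+g =
  cong (isOdd n xor_) (thueMorseFuel-irrelevant (half≤ n≤1+f) (half≤ n≤1+g))
  where
  half≤ : ∀ {h} → n ≤ suc h → ⌊ n /2⌋ ≤ h
  half≤ {h} n≤1+h = ≤-pred (≤-trans (s≤s (⌊n/2⌋-mono n≤1+h)) (⌊n/2⌋<n h))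

isOdd-double : ∀ n → isOdd (n + n) ≡ false
isOdd-double zero    = refl
isOdd-double (suc n) rewrite +-suc n n | isOdd-double n = refl

⌊1+n+n/2⌋≡n : ∀ n → ⌊ suc (n + n) /2⌋ ≡ n
⌊1+n+n/2⌋≡n zero    = refl
⌊1+n+n/2⌋≡n (suc n) rewrite +-suc n n = cong suc (⌊1+n+n/2⌋≡n n)

opaque
  unfolding thueMorse

  thueMorse-double : ∀ n → thueMorse (n + n) ≡ thueMorse n
  thueMorse-double n rewrite isOdd-double n | sym (n≡⌊n+n/2⌋ n) =
    thueMorseFuel-irrelevant (m≤m+n n n) (n≤1+n n)

  thueMorse-suc-double : ∀ n → thueMorse (suc (n + n)) ≡ not (thueMorse n)
  thueMorse-suc-double n rewrite isOdd-double n | ⌊1+n+n/2⌋≡n n =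
    cong not (thueMorseFuel-irrelevant (m≤n⇒m≤1+n (m≤m+n n n)) (n≤1+n n))

thueMorse-interleave : ∀ x → thueMorse x ≡ interleave thueMorse (not ∘ thueMorse) x
thueMorse-interleave x with evenOdd x
... | even m = trans (thueMorse-double m) (sym (interleave-double m))
... | odd m  = trans (thueMorse-suc-double m) (sym (interleave-suc-double {v = thueMorse} m))

thueMorse-flip : ∀ m {y} → m + m ≡ y → thueMorse (suc y) ≡ not (thueMorse y)
thueMorse-flip m refl = trans (thueMorse-suc-double m) (cong not (sym (thueMorse-double m)))

thueMorse-no-triple : ∀ x → thueMorse x ≡ thueMorse (suc x) →
                      thueMorse (suc x) ≡ thueMorse (suc (suc x)) → ⊥
thueMorse-no-triple x e₁ e₂ with evenOdd x
... | even m = not-¬ refl (trans e₁ (thueMorse-flip m refl))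
... | odd m  = not-¬ refl (trans e₂ (thueMorse-flip (suc m) (cong suc (+-suc m m))))

OverlapFree : (ℕ → A) → Set
OverlapFree s = ∀ i p → ¬ Agree s i (i + suc p) (suc p)

-- An odd shift places the pair (2e, 2e+1), on which thueMorse always flips, over (2o+1, 2o+2), where
-- thueMorse flips exactly when it does not flip at o.
agree-odd-shift : ∀ {e o} → Agree thueMorse (e + e) (suc (o + o)) 1 → thueMorse (suc o) ≡ thueMorse o
agree-odd-shift {e} {o} ag = begin
  thueMorse (suc o)               ≡⟨ sym (thueMorse-double (suc o)) ⟩
  thueMorse (suc o + suc o)       ≡⟨ cong (thueMorse ∘ suc) (+-suc o o) ⟩
  thueMorse (suc (suc (o + o)))   ≡⟨ sym (agree-head (agree-tail ag)) ⟩
  thueMorse (suc (e + e))         ≡⟨ thueMorse-flip e refl ⟩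
  not (thueMorse (e + e))         ≡⟨ cong not (agree-head ag) ⟩
  not (thueMorse (suc (o + o)))   ≡⟨ cong not (thueMorse-suc-double o) ⟩
  not (not (thueMorse o))         ≡⟨ not-involutive _ ⟩
  thueMorse o                     ∎
  where open ≡-Reasoning

no-odd-shift-agreement : ∀ e o → ¬ Agree thueMorse (e + e) (suc (o + o)) 3
no-odd-shift-agreement e o ag =
  thueMorse-no-triple o (sym (agree-odd-shift {e} (agree-weaken (s≤s z≤n) ag)))
                        (sym (agree-odd-shift {suc e} shifted))
  where
  shifted : Agree thueMorse (suc e + suc e) (suc (suc o + suc o)) 1
  shifted = subst₂ (λ a b → Agree thueMorse a b 1)
                   (cong suc (sym (+-suc e e))) (cong (suc ∘ suc) (sym (+-suc o o)))
                   (agree-tail (agree-tail ag))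

overlap-odd-period : ∀ i k → ¬ Agree thueMorse i (i + suc (k + k)) 3
overlap-odd-period i k ag with evenOdd i
... | even m = no-odd-shift-agreement m (m + k)
                 (subst (λ b → Agree thueMorse (m + m) b 3) (double-+-odd m k) ag)
... | odd m  = no-odd-shift-agreement (suc (m + k)) m
                 (agree-sym (subst (λ b → Agree thueMorse (suc (m + m)) b 3) (odd-+-odd m k) ag))

overlap-even-period : ∀ i q → Agree thueMorse i (i + (q + q)) (q + q) →
                      Σ ℕ λ i′ → Agree thueMorse i′ (i′ + q) q
overlap-even-period i q ag with evenOdd i
... | even m = m , agree-interleave-even (agree-cong thueMorse-interleave
                     (subst (λ b → Agree thueMorse (m + m) b (q + q)) (double-+-double m q) ag))
... | odd m  = m , agree-injective not-injective (agree-interleave-odd (agree-cong thueMorse-interleave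
                     (subst (λ b → Agree thueMorse (suc (m + m)) b (q + q))
                            (cong suc (double-+-double m q)) ag)))

thueMorse-overlapFree : OverlapFree thueMorse
thueMorse-overlapFree i p = <-rec (λ p → ∀ i → ¬ Agree thueMorse i (i + suc p) (suc p)) step p i
  where
  step : ∀ p → (∀ {q} → q < p → ∀ i → ¬ Agree thueMorse i (i + suc q) (suc q)) →
         ∀ i → ¬ Agree thueMorse i (i + suc p) (suc p)
  step p rec i ag with evenOdd p
  ... | even zero    = thueMorse-no-triple i (agree-head ag′) (agree-head (agree-tail ag′))
    where
    ag′ : Agree thueMorse i (suc i) 1
    ag′ = subst (λ b → Agree thueMorse i b 1) (+-comm i 1) ag
  ... | even (suc k) = overlap-odd-period i (suc k) (agree-weaken 3≤period ag)
    where
    3≤period : 3 ≤ suc (suc k + suc k)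
    3≤period = s≤s (+-mono-≤ (s≤s z≤n) (s≤s z≤n))
  ... | odd m with overlap-even-period i (suc m)
                     (subst (λ q → Agree thueMorse i (i + q) q) (cong suc (sym (+-suc m m))) ag)
  ...   | i′ , ag′ = rec (s≤s (m≤m+n m m)) i′ ag′

module _ (s : ℕ → Bool) where

  vertexPair edgePair : ℕ → Bool × Bool
  vertexPair x = s x , s (suc x)
  edgePair   x = not (s (suc x)) , s x

  private
    agree-with-successor : ∀ {a b L} → Agree s a b L → Agree (s ∘ suc) a b L → Agree s a b (suc L)
    agree-with-successor {a} {b} {L} ag ag-suc = agree-extend ag
      (subst₂ (λ x y → s x ≡ s y) (sym (+-suc a L)) (sym (+-suc b L)) (ag-suc .at L ≤-refl))

  vertexPair-squareFree : OverlapFree s → SquareFree vertexPair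
  vertexPair-squareFree of p m ag =
    of p m (agree-with-successor (agree-map proj₁ ag) (agree-map proj₂ ag))

  edgePair-squareFree : OverlapFree s → SquareFree edgePair
  edgePair-squareFree of p m ag =
    of p m (agree-with-successor (agree-map proj₂ ag) (agree-injective not-injective (agree-map proj₁ ag)))

  vertexPair≢edgePair : ∀ i → vertexPair i ≢ edgePair i
  vertexPair≢edgePair i eq = not-¬ (sym (cong proj₂ eq)) (cong proj₁ eq)

  edgePair≢vertexPair-suc : ∀ i → edgePair i ≢ vertexPair (suc i)
  edgePair≢vertexPair-suc i eq = not-¬ refl (sym (cong proj₁ eq))

  pairs-mismatch : ∀ i n → vertexPair i ≡ edgePair n → edgePair i ≡ vertexPair (suc n) →
                   vertexPair (suc i) ≡ edgePair (suc n) → ⊥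
  pairs-mismatch i n e₀ e₁ e₂ = not-¬ (sym constant) alternating
    where
    constant : s i ≡ s (suc i)
    constant = trans (cong proj₁ e₀) (trans (cong not (sym (cong proj₁ e₁))) (not-involutive _))
    alternating : s (suc i) ≡ not (s i)
    alternating = trans (cong proj₁ e₂) (cong not (sym (cong proj₂ e₁)))

  private
    T = interleave vertexPair edgePair

    vertexPair-at : ∀ x → T (x + x) ≡ vertexPair x
    vertexPair-at = interleave-double

    edgePair-at : ∀ x → T (suc (x + x)) ≡ edgePair x
    edgePair-at = interleave-suc-double {v = vertexPair}

    odd-shift-agreement : ∀ i n → ¬ Agree T (i + i) (suc (n + n)) 2
    odd-shift-agreement i n ag = pairs-mismatch i n e₀ e₁ e₂
      where
      e₀ : vertexPair i ≡ edgePair n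
      e₀ = trans (sym (vertexPair-at i)) (trans (agree-head ag) (edgePair-at n))
      e₁ : edgePair i ≡ vertexPair (suc n)
      e₁ = trans (sym (edgePair-at i)) (trans (agree-head (agree-tail ag)) (interleave-double n))
      e₂ : vertexPair (suc i) ≡ edgePair (suc n)
      e₂ = trans (sym (interleave-double i)) (trans (agree-head (agree-tail (agree-tail ag)))
                                                    (interleave-suc-double {v = vertexPair ∘ suc} n))

    period-one : ∀ p → T p ≢ T (suc p)
    period-one p eq with evenOdd p
    ... | even i = vertexPair≢edgePair i (trans (sym (vertexPair-at i)) (trans eq (edgePair-at i)))
    ... | odd i  = edgePair≢vertexPair-suc i (trans (sym (edgePair-at i)) (trans eq (interleave-double i)))

    no-odd-square : ∀ p m → ¬ Agree T p (p + suc (m + m)) (m + m)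
    no-odd-square p zero    ag = period-one p (trans (agree-head ag) (cong T (+-comm p 1)))
    no-odd-square p (suc k) ag with evenOdd p | agree-weaken (+-mono-≤ (s≤s z≤n) (s≤s z≤n)) ag
    ... | even i | ag₂ = odd-shift-agreement i (i + suc k)
                           (subst (λ b → Agree T (i + i) b 2) (double-+-odd i (suc k)) ag₂)
    ... | odd i  | ag₂ = odd-shift-agreement (suc (i + suc k)) i
                           (agree-sym (subst (λ b → Agree T (suc (i + i)) b 2) (odd-+-odd i (suc k)) ag₂))

  interleave-pairs-squareFree : OverlapFree s → SquareFree (interleave vertexPair edgePair)
  interleave-pairs-squareFree of =
    interleave-squareFree (vertexPair-squareFree of) (edgePair-squareFree of) no-odd-square

module _ {c} (φ : TotalColouring c) where

  private
    T = interleave (vcol φ) (ecol φ)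

    vcol-at : ∀ x → vcol φ x ≡ T (x + x)
    vcol-at x = sym (interleave-double x)

    ecol-at : ∀ x → ecol φ x ≡ T (suc (x + x))
    ecol-at x = sym (interleave-suc-double {v = vcol φ} x)

    ⊓-suc : ∀ a → a ⊓ suc a ≡ a
    ⊓-suc a = m≤n⇒m⊓n≡m (n≤1+n a)

    suc-⊓ : ∀ a → suc a ⊓ a ≡ a
    suc-⊓ a = m≥n⇒m⊓n≡n (n≤1+n a)

  edgeSeq-ascending : ∀ a k → edgeSeq φ (ascending a (suc k)) ≡ map (ecol φ) (ascending a k)
  edgeSeq-ascending a zero    = refl
  edgeSeq-ascending a (suc k) = cong₂ _∷_ (cong (ecol φ) (⊓-suc a)) (edgeSeq-ascending (suc a) k)

  edgeSeq-descending : ∀ b k → edgeSeq φ (descending b (suc k)) ≡ map (ecol φ) (descending b k)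
  edgeSeq-descending b zero    = refl
  edgeSeq-descending b (suc k) = cong₂ _∷_ (cong (ecol φ) (suc-⊓ (k + b))) (edgeSeq-descending b k)

  totalSeq-ascending : ∀ a k → totalSeq φ (ascending a (suc k)) ≡ map T (ascending (a + a) (suc (k + k)))
  totalSeq-ascending a zero    = cong (_∷ []) (vcol-at a)
  totalSeq-ascending a (suc k) =
    cong₂ _∷_ (vcol-at a)
      (cong₂ _∷_ (trans (cong (ecol φ) (⊓-suc a)) (ecol-at a))
        (trans (totalSeq-ascending (suc a) k)
               (cong₂ (λ x L → map T (ascending x L)) (cong suc (+-suc a a)) (sym (+-suc k k)))))

  totalSeq-descending : ∀ b k → totalSeq φ (descending b (suc k)) ≡
                                map T (descending (b + b) (suc (k + k)))
  totalSeq-descending b zero    = cong (_∷ []) (vcol-at b)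
  totalSeq-descending b (suc k) =
    cong₂ _∷_ (trans (vcol-at (suc k + b)) (cong T (sym (double-+-double (suc k) b))))
      (cong₂ _∷_ (trans (cong (ecol φ) (suc-⊓ (k + b)))
                        (trans (ecol-at (k + b)) (cong T (odd-position k b))))
        (trans (totalSeq-descending b k) (cong (map T ∘ descending (b + b)) (sym (+-suc k k)))))
    where
    odd-position : ∀ k b → suc ((k + b) + (k + b)) ≡ k + suc k + (b + b)
    odd-position = solve-∀

data Straight : List ℕ → Set where
  up   : ∀ a k → Straight (ascending a (suc k))
  down : ∀ b k → Straight (descending b (suc k))

straight : ∀ {vs} → vs ≢ [] → Unique vs → Linked Adjacent vs → Straight vs
straight {[]}         vs≢[] _ _ = ⊥-elim (vs≢[] refl)
straight {x ∷ []}     _ _ _ = up x 0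
straight {x ∷ y ∷ ys} _ (x∉ ∷ u) (x~y ∷ lk) with straight (λ ()) u lk | x~y
... | up .y k          | inj₁ refl = up x (suc k)
... | up .y zero       | inj₂ refl = down y 1
... | up .y (suc k)    | inj₂ refl with x∉
...   | _ ∷ x≢x ∷ _ = ⊥-elim (x≢x refl)
straight {x ∷ y ∷ ys} _ (x∉ ∷ u) (x~y ∷ lk) | down b k | inj₂ refl = down b (suc k)
straight {x ∷ y ∷ ys} _ (x∉ ∷ u) (x~y ∷ lk) | down b zero | inj₁ refl = up x 1
straight {x ∷ y ∷ ys} _ (x∉ ∷ u) (x~y ∷ lk) | down b (suc k) | inj₁ 1+x≡y with x∉
...   | _ ∷ x≢y′ ∷ _ = ⊥-elim (x≢y′ (suc-injective 1+x≡y))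

squareFree⇒totalThue : ∀ {c} (φ : TotalColouring c) → SquareFree (vcol φ) → SquareFree (ecol φ) →
  SquareFree (interleave (vcol φ) (ecol φ)) → ∀ n → IsTotalThue n φ
squareFree⇒totalThue φ sf-v sf-e sf-t n vs (vs≢[] , _ , u , lk) with straight vs≢[] u lk
... | up a k   = subst Nonrepetitive (sym (totalSeq-ascending φ a k)) (squareFree-ascending sf-t _ _)
               , squareFree-ascending sf-v a (suc k)
               , subst Nonrepetitive (sym (edgeSeq-ascending φ a k)) (squareFree-ascending sf-e a k)
... | down b k = subst Nonrepetitive (sym (totalSeq-descending φ b k)) (squareFree-descending sf-t _ _)
               , squareFree-descending sf-v b (suc k)
               , subst Nonrepetitive (sym (edgeSeq-descending φ b k)) (squareFree-descending sf-e b k)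

encode : Bool × Bool → Fin 4
encode (false , false) = Fin.zero
encode (false , true)  = Fin.suc Fin.zero
encode (true  , false) = Fin.suc (Fin.suc Fin.zero)
encode (true  , true)  = Fin.suc (Fin.suc (Fin.suc Fin.zero))

decode : Fin 4 → Bool × Bool
decode Fin.zero                             = false , false
decode (Fin.suc Fin.zero)                   = false , true
decode (Fin.suc (Fin.suc Fin.zero))         = true , false
decode (Fin.suc (Fin.suc (Fin.suc Fin.zero))) = true , true

decode-encode : ∀ x → decode (encode x) ≡ x
decode-encode (false , false) = refl
decode-encode (false , true)  = refl
decode-encode (true  , false) = refl
decode-encode (true  , true)  = refl

colour : Bool × Bool → Fin 5
colour = inject₁ ∘ encode

colour-injective : ∀ {x y} → colour x ≡ colour y → x ≡ y
colour-injective {x} {y} eq =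
  trans (sym (decode-encode x)) (trans (cong decode (inject₁-injective eq)) (decode-encode y))

thueMorseColouring : TotalColouring 5
thueMorseColouring = mkCol (colour ∘ vertexPair thueMorse) (colour ∘ edgePair thueMorse)

thueMorseColouring-totalThue : ∀ n → IsTotalThue n thueMorseColouring
thueMorseColouring-totalThue = squareFree⇒totalThue thueMorseColouring
  (squareFree-∘ colour-injective (vertexPair-squareFree thueMorse thueMorse-overlapFree))
  (squareFree-∘ colour-injective (edgePair-squareFree thueMorse thueMorse-overlapFree))
  (squareFree-cong (λ x → sym (interleave-∘ colour (vertexPair thueMorse) (edgePair thueMorse) x))
    (squareFree-∘ colour-injective (interleave-pairs-squareFree thueMorse thueMorse-overlapFree)))

adjacent-distinct : ∀ (xs : List A) {x y ys} → Nonrepetitive (xs ++ x ∷ y ∷ ys) → x ≢ y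
adjacent-distinct xs nr refl = nr (xs , _ ∷ [] , _ , (λ ()) , refl)

period-three : ∀ {a₀ e₀ a₁ e₁ a₂ e₂ : A} {rest} → e₁ ≡ a₀ → a₂ ≡ e₀ → e₂ ≡ a₁ →
  Repetitive (a₀ ∷ e₀ ∷ a₁ ∷ e₁ ∷ a₂ ∷ e₂ ∷ rest)
period-three refl refl refl = [] , _ ∷ _ ∷ _ ∷ [] , _ , (λ ()) , refl

third-colour : ∀ {c} → c < 4 → {x y z w : Fin c} → x ≢ y → z ≢ x → z ≢ y → w ≢ x → w ≢ y → z ≡ w
third-colour c<4 {x} {y} {z} {w} x≢y z≢x z≢y w≢x w≢y = decidable-stable (z Fin.≟ w) λ z≢w →
  <⇒≱ c<4 (injective⇒≤ (λ {i} {j} → lookup-injective (distinct z≢w) i j))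
  where
  distinct : z ≢ w → Vec.Unique (w ∷ z ∷ y ∷ x ∷ [])
  distinct z≢w = (≢-sym z≢w ∷ w≢y ∷ w≢x ∷ []) ∷ (z≢y ∷ z≢x ∷ []) ∷ (≢-sym x≢y ∷ []) ∷ [] ∷ []

path-0123 : ∀ {n} → 4 ≤ n → IsPath n (0 ∷ 1 ∷ 2 ∷ 3 ∷ [])
path-0123 4≤n =
  (λ ()) ,
  (below (s≤s z≤n) ∷ below (s≤s (s≤s z≤n)) ∷ below (s≤s (s≤s (s≤s z≤n))) ∷ below ≤-refl ∷ []) ,
  (((λ ()) ∷ (λ ()) ∷ (λ ()) ∷ []) ∷ ((λ ()) ∷ (λ ()) ∷ []) ∷ ((λ ()) ∷ []) ∷ [] ∷ []) ,
  (inj₁ refl ∷ inj₁ refl ∷ inj₁ refl ∷ [-])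
  where
  below : ∀ {i} → i < 4 → i < _
  below i<4 = <-≤-trans i<4 4≤n

no-total-Thue-below-4 : ∀ {n} → 4 ≤ n → ∀ c → c < 4 → ¬ HasTotalThue n c
no-total-Thue-below-4 4≤n c c<4 (φ , thue) with thue (0 ∷ 1 ∷ 2 ∷ 3 ∷ []) (path-0123 4≤n)
... | total , vertices , edges = total (period-three e₁≡a₀ a₂≡e₀ e₂≡a₁)
  where
  a₀≢e₀ = adjacent-distinct [] total
  e₀≢a₁ = adjacent-distinct (_ ∷ []) total
  a₁≢e₁ = adjacent-distinct (_ ∷ _ ∷ []) total
  e₁≢a₂ = adjacent-distinct (_ ∷ _ ∷ _ ∷ []) total
  a₂≢e₂ = adjacent-distinct (_ ∷ _ ∷ _ ∷ _ ∷ []) total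
  a₀≢a₁ = adjacent-distinct [] vertices
  a₁≢a₂ = adjacent-distinct (_ ∷ []) vertices
  e₀≢e₁ = adjacent-distinct [] edges
  e₁≢e₂ = adjacent-distinct (_ ∷ []) edges
  e₁≡a₀ = third-colour c<4 e₀≢a₁ (≢-sym e₀≢e₁) (≢-sym a₁≢e₁) a₀≢e₀ a₀≢a₁
  a₂≡e₀ = third-colour c<4 a₁≢e₁ (≢-sym a₁≢a₂) (≢-sym e₁≢a₂) e₀≢a₁ e₀≢e₁
  e₂≡a₁ = third-colour c<4 e₁≢a₂ (≢-sym e₁≢e₂) (≢-sym a₂≢e₂) a₁≢e₁ a₁≢a₂

theorem14 : (n : ℕ) → 4 ≤ n →
    ((c : ℕ) → c < 4 → ¬ HasTotalThue n c) × HasTotalThue n 5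
theorem14 n 4≤n = no-total-Thue-below-4 4≤n , (thueMorseColouring , thueMorseColouring-totalThue n)
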